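{- Let $G$ be a regular closed distance magic graph that has a perfect code. Then the multiplicity of $-1$ as an eigenvalue of the adjacency matrix of $G$ is at least $2$.
   Context: A perfect code of $G$ is a subset $C\subseteq V(G)$ such that the closed neighborhoods $N[v]$, $v\in C$, form a partition of $V(G)$. A graph $G$ on $n$ vertices is closed distance magic if there is a bijection $\ell\colon V(G)\to\{1,\dots,n\}$ and a positive integer $k'$ such that $\sum_{y\in N[x]}\ell(y)=k'$ for every vertex $x$, where $N[x]$ is the closed neighborhood of $x$. -}

module Defs where

open import Data.Nat as ℕ using (ℕ; zero; suc; _<_; _≤_)
open import Data.Fin using (Fin; zero; suc; toℕ)
open import Data.Bool using (Bool; true; false; if_then_else_; _∨_; T)
open import Data.Rational as ℚ using (ℚ; 0ℚ; 1ℚ)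
open import Data.Product using (Σ; ∃; _×_; _,_)
open import Data.Unit using (⊤)
open import Data.Empty using (⊥)
open import Relation.Binary.PropositionalEquality using (_≡_)
open import Function.Bundles using (_↔_; Inverse)
open import Relation.Nullary using (¬_)
open import Relation.Nullary.Decidable using (⌊_⌋)
open import Data.Fin.Properties using () renaming (_≟_ to _≟ᶠ_)

Σℕ : (n : ℕ) → (Fin n → ℕ) → ℕ
Σℕ zero    f = 0
Σℕ (suc n) f = f zero ℕ.+ Σℕ n (λ i → f (suc i))

Σℚ : (n : ℕ) → (Fin n → ℚ) → ℚ
Σℚ zero    f = 0ℚ
Σℚ (suc n) f = f zero ℚ.+ Σℚ n (λ i → f (suc i))

record Graph (n : ℕ) : Set where
  field
    adj   : Fin n → Fin n → Bool
    sym   : ∀ x y → adj x y ≡ adj y x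
    irrefl : ∀ x → adj x x ≡ false
open Graph public

inN[] : ∀ {n} → Graph n → Fin n → Fin n → Bool
inN[] G x y = ⌊ x ≟ᶠ y ⌋ ∨ adj G x y

degree : ∀ {n} → Graph n → Fin n → ℕ
degree {n} G x = Σℕ n (λ y → if adj G x y then 1 else 0)

Regular : ∀ {n} → Graph n → Set
Regular {n} G = ∃ λ (r : ℕ) → ∀ x → degree G x ≡ r

closedNbSum : ∀ {n} → Graph n → (Fin n → ℕ) → Fin n → ℕ
closedNbSum {n} G ℓ x = Σℕ n (λ y → if inN[] G x y then ℓ y else 0)

-- Closed distance magic: a bijection ℓ : V → {1,…,n} (encoded as a
-- bijection σ : Fin n ↔ Fin n, with ℓ(v) = toℕ (σ v) + 1) and a positive
-- integer k' with Σ_{y ∈ N[x]} ℓ(y) = k' for all x.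
ClosedDistanceMagic : ∀ {n} → Graph n → Set
ClosedDistanceMagic {n} G =
  Σ (Fin n ↔ Fin n) λ σ → ∃ λ (k' : ℕ) → (0 < k') ×
    (∀ x → closedNbSum G (λ y → suc (toℕ (Inverse.to σ y))) x ≡ k')

PerfectCode : ∀ {n} → Graph n → (Fin n → Bool) → Set
PerfectCode {n} G C =
  ∀ v → Σ (Fin n) λ c → (T (C c) × T (inN[] G c v)) ×
        (∀ c' → T (C c') → T (inN[] G c' v) → c' ≡ c)

HasPerfectCode : ∀ {n} → Graph n → Set
HasPerfectCode {n} G = Σ (Fin n → Bool) λ C → PerfectCode G C

adjMatrix : ∀ {n} → Graph n → Fin n → Fin n → ℚ
adjMatrix G i j = if adj G i j then 1ℚ else 0ℚ

-- v is an eigenvector of M for eigenvalue λ (v need not be nonzero here;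
-- nonzeroness follows from linear independence below)
IsEigenvectorFor : ∀ {n} → (Fin n → Fin n → ℚ) → ℚ → (Fin n → ℚ) → Set
IsEigenvectorFor {n} M λ' v = ∀ i → Σℚ n (λ j → M i j ℚ.* v j) ≡ λ' ℚ.* v i

LinearlyIndependent : ∀ {n m} → (Fin m → Fin n → ℚ) → Set
LinearlyIndependent {n} {m} vs =
  ∀ (c : Fin m → ℚ) → (∀ i → Σℚ m (λ k → c k ℚ.* vs k i) ≡ 0ℚ) → ∀ k → c k ≡ 0ℚ

-- The (geometric = algebraic, M symmetric) multiplicity of λ as an
-- eigenvalue of M is at least m: the λ-eigenspace has dimension ≥ m.
MultiplicityAtLeast : ∀ {n} → ℕ → (Fin n → Fin n → ℚ) → ℚ → Set
MultiplicityAtLeast {n} m M λ' =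
  Σ (Fin m → Fin n → ℚ) λ vs →
    LinearlyIndependent vs × (∀ k → IsEigenvectorFor M λ' (vs k))

{-# OPTIONS --safe #-}
module Submission where

-- Let ℓ be a closed distance magic labelling with constant k, χ the indicator vector of a
-- perfect code C, 𝟙 the all-ones vector and r the degree. Writing N for the closed
-- neighbourhood operator A + I, we have N ℓ = k 𝟙, N χ = 𝟙 and N 𝟙 = (r + 1) 𝟙, so
-- u = ℓ − k χ and w = (r + 1) χ − 𝟙 lie in ker N, the (−1)-eigenspace of A.
-- They are independent: among three vertices two agree on χ, hence on w, but not on u since
-- ℓ is injective; and some vertex z lies outside C (otherwise G would be edgeless and ℓ
-- constant), so w z = −1 ≠ 0.

open import Defs hiding (sym)
open import Data.Nat using (ℕ; _≤_)
open import Data.Rational using (ℚ; -_; 1ℚ)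

open import Algebra.Bundles using (Ring)
open import Data.Bool using (Bool; true; false; if_then_else_; _∨_; T)
open import Data.Bool.Properties using (T?; T-≡; T-∨; if-float; ¬-not)
open import Data.Empty using (⊥-elim)
open import Data.Fin using (Fin; zero; suc; toℕ)
open import Data.Fin.Properties
  using (toℕ-injective; suc-injective; <⇒≢; pigeonhole; ¬∀⟶∃¬; 2↔Bool)
  renaming (_≟_ to _≟ᶠ_)
open import Data.Nat using (zero; suc)
import Data.Nat as ℕ
import Data.Nat.Properties as ℕ
open import Data.Product using (∃; ∃₂; _×_; _,_; map₂)
open import Data.Rational using (0ℚ; _+_; _*_; 1/_; ≢-nonZero) renaming (_≤_ to _≤ℚ_)
import Data.Rational.Properties as ℚ
open import Data.Sum using (inj₁; inj₂)
open import Data.Vec.Functional using (_∷_; [])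
open import Function using (_∘_; Inverse; Injection; Equivalence)
open import Function.Properties.Inverse using (↔⇒↣; ↔-sym)
open import Relation.Binary.PropositionalEquality
  using (_≡_; _≢_; _≗_; refl; sym; trans; cong; cong₂; module ≡-Reasoning)
open import Relation.Nullary using (¬_; yes; no)
open import Relation.Nullary.Decidable using (⌊_⌋; fromWitness; isYes≗does; dec-true; dec-false)

open import Algebra.Properties.Group ℚ.+-0-group using (∙-cancelˡ; ∙-cancelʳ)
open import Algebra.Properties.Ring ℚ.+-*-ring using (-1*x≈-x)
open import Algebra.Properties.Semiring.Sum (Ring.semiring ℚ.+-*-ring)
  using (sum; sum-cong-≗; sum-replicate-zero; ∑-distrib-+; *-distribˡ-sum)
open import Algebra.Properties.Semiring.Mult (Ring.semiring ℚ.+-*-ring)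
  using (×-homo-+) renaming (_×_ to _×′_)

open ≡-Reasoning

Σℚ≡sum : ∀ n (f : Fin n → ℚ) → Σℚ n f ≡ sum f
Σℚ≡sum zero    f = refl
Σℚ≡sum (suc n) f = cong (f zero +_) (Σℚ≡sum n (f ∘ suc))

Σℚ-cong : ∀ n {f g : Fin n → ℚ} → f ≗ g → Σℚ n f ≡ Σℚ n g
Σℚ-cong n {f} {g} f≗g = begin
  Σℚ n f ≡⟨ Σℚ≡sum n f ⟩
  sum f  ≡⟨ sum-cong-≗ f≗g ⟩
  sum g  ≡⟨ Σℚ≡sum n g ⟨
  Σℚ n g ∎

Σℚ-zero : ∀ n {f : Fin n → ℚ} → (∀ j → f j ≡ 0ℚ) → Σℚ n f ≡ 0ℚ
Σℚ-zero n f≗0 = trans (Σℚ-cong n f≗0) (trans (Σℚ≡sum n _) (sum-replicate-zero n))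

Σℚ-distrib-+ : ∀ n (f g : Fin n → ℚ) → Σℚ n (λ j → f j + g j) ≡ Σℚ n f + Σℚ n g
Σℚ-distrib-+ n f g = begin
  Σℚ n (λ j → f j + g j) ≡⟨ Σℚ≡sum n _ ⟩
  sum (λ j → f j + g j)  ≡⟨ ∑-distrib-+ f g ⟩
  sum f + sum g          ≡⟨ cong₂ _+_ (Σℚ≡sum n f) (Σℚ≡sum n g) ⟨
  Σℚ n f + Σℚ n g        ∎

Σℚ-linear : ∀ n a b (f g : Fin n → ℚ) →
            Σℚ n (λ j → a * f j + b * g j) ≡ a * Σℚ n f + b * Σℚ n g
Σℚ-linear n a b f g = begin
  Σℚ n (λ j → a * f j + b * g j)            ≡⟨ Σℚ-distrib-+ n _ _ ⟩
  Σℚ n (λ j → a * f j) + Σℚ n (λ j → b * g j)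
    ≡⟨ cong₂ _+_ (Σℚ≡sum n _) (Σℚ≡sum n _) ⟩
  sum (λ j → a * f j) + sum (λ j → b * g j) ≡⟨ cong₂ _+_ (*-distribˡ-sum a f) (*-distribˡ-sum b g) ⟨
  a * sum f + b * sum g                     ≡⟨ cong₂ (λ s t → a * s + b * t) (Σℚ≡sum n f) (Σℚ≡sum n g) ⟨
  a * Σℚ n f + b * Σℚ n g                   ∎

Σℚ-single : ∀ n (c : Fin n) (f : Fin n → ℚ) → (∀ j → j ≢ c → f j ≡ 0ℚ) → Σℚ n f ≡ f c
Σℚ-single (suc n) zero f off = begin
  f zero + Σℚ n (f ∘ suc) ≡⟨ cong (f zero +_) (Σℚ-zero n (λ j → off (suc j) λ ())) ⟩
  f zero + 0ℚ             ≡⟨ ℚ.+-identityʳ (f zero) ⟩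
  f zero                  ∎
Σℚ-single (suc n) (suc c) f off = begin
  f zero + Σℚ n (f ∘ suc) ≡⟨ cong₂ _+_ (off zero λ ())
                               (Σℚ-single n c (f ∘ suc) (λ j j≢c → off (suc j) (j≢c ∘ suc-injective))) ⟩
  0ℚ + f (suc c)          ≡⟨ ℚ.+-identityˡ (f (suc c)) ⟩
  f (suc c)               ∎

fromℕ : ℕ → ℚ
fromℕ n = n ×′ 1ℚ

fromℕ-Σ : ∀ n (f : Fin n → ℕ) → fromℕ (Σℕ n f) ≡ Σℚ n (fromℕ ∘ f)
fromℕ-Σ zero    f = refl
fromℕ-Σ (suc n) f = trans (×-homo-+ 1ℚ (f zero) _) (cong (fromℕ (f zero) +_) (fromℕ-Σ n (f ∘ suc)))

fromℕ-nonNegative : ∀ n → 0ℚ ≤ℚ fromℕ n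
fromℕ-nonNegative zero    = ℚ.≤-refl
fromℕ-nonNegative (suc n) = ℚ.+-mono-≤ (ℚ.nonNegative⁻¹ 1ℚ) (fromℕ-nonNegative n)

fromℕ-suc≢0 : ∀ n → fromℕ (suc n) ≢ 0ℚ
fromℕ-suc≢0 n = ℚ.<⇒≢ (ℚ.+-mono-<-≤ (ℚ.positive⁻¹ 1ℚ) (fromℕ-nonNegative n)) ∘ sym

fromℕ-injective : ∀ {m n} → fromℕ m ≡ fromℕ n → m ≡ n
fromℕ-injective {zero}  {zero}  _ = refl
fromℕ-injective {zero}  {suc n} e = ⊥-elim (fromℕ-suc≢0 n (sym e))
fromℕ-injective {suc m} {zero}  e = ⊥-elim (fromℕ-suc≢0 m e)
fromℕ-injective {suc m} {suc n} e = cong suc (fromℕ-injective (∙-cancelˡ 1ℚ _ _ e))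

*-cancelˡ-≢0 : ∀ p {q r} → p ≢ 0ℚ → p * q ≡ p * r → q ≡ r
*-cancelˡ-≢0 p {q} {r} p≢0 pq≡pr =
  trans (undo q) (trans (cong (1/ p *_) pq≡pr) (sym (undo r)))
  where
  instance _ = ≢-nonZero p≢0
  undo : ∀ x → x ≡ 1/ p * (p * x)
  undo x = begin
    x                ≡⟨ ℚ.*-identityˡ x ⟨
    1ℚ * x           ≡⟨ cong (_* x) (ℚ.*-inverseˡ p) ⟨
    (1/ p * p) * x   ≡⟨ ℚ.*-assoc (1/ p) p x ⟩
    1/ p * (p * x)   ∎

independent-pair : ∀ {n} (u w : Fin n → ℚ) {x y z : Fin n} →
                   w x ≡ w y → u x ≢ u y → w z ≢ 0ℚ → LinearlyIndependent (u ∷ w ∷ [])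
independent-pair u w {x} {y} {z} wx≡wy ux≢uy wz≢0 c combination≡0 = λ where
    zero       → c₀≡0
    (suc zero) → c₁≡0
  where
  -- combination≡0 i unfolds to  c₀ * u i + (c₁ * w i + 0ℚ) ≡ 0ℚ.
  c₀ c₁ : ℚ
  c₀ = c zero
  c₁ = c (suc zero)

  c₀u-agrees : c₀ * u x ≡ c₀ * u y
  c₀u-agrees = ∙-cancelʳ (c₁ * w y + 0ℚ) _ _ (begin
    c₀ * u x + (c₁ * w y + 0ℚ) ≡⟨ cong (λ t → c₀ * u x + (c₁ * t + 0ℚ)) wx≡wy ⟨
    c₀ * u x + (c₁ * w x + 0ℚ) ≡⟨ combination≡0 x ⟩
    0ℚ                         ≡⟨ combination≡0 y ⟨
    c₀ * u y + (c₁ * w y + 0ℚ) ∎)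

  c₀≡0 : c₀ ≡ 0ℚ
  c₀≡0 with c₀ ℚ.≟ 0ℚ
  ... | yes c₀≡0 = c₀≡0
  ... | no  c₀≢0 = ⊥-elim (ux≢uy (*-cancelˡ-≢0 c₀ c₀≢0 c₀u-agrees))

  c₁≡0 : c₁ ≡ 0ℚ
  c₁≡0 = *-cancelˡ-≢0 (w z) wz≢0 (begin
    w z * c₁                    ≡⟨ ℚ.*-comm (w z) c₁ ⟩
    c₁ * w z                    ≡⟨ ℚ.+-identityʳ (c₁ * w z) ⟨
    c₁ * w z + 0ℚ               ≡⟨ ℚ.+-identityˡ _ ⟨
    0ℚ + (c₁ * w z + 0ℚ)        ≡⟨ cong (_+ (c₁ * w z + 0ℚ)) (ℚ.*-zeroˡ (u z)) ⟨
    0ℚ * u z + (c₁ * w z + 0ℚ)  ≡⟨ cong (λ t → t * u z + (c₁ * w z + 0ℚ)) c₀≡0 ⟨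
    c₀ * u z + (c₁ * w z + 0ℚ)  ≡⟨ combination≡0 z ⟩
    0ℚ                          ≡⟨ ℚ.*-zeroʳ (w z) ⟨
    w z * 0ℚ                    ∎)

indicator : ∀ {n} → (Fin n → Bool) → Fin n → ℚ
indicator C v = if C v then 1ℚ else 0ℚ

Bool-pigeonhole : ∀ {n} → 2 ℕ.< n → (C : Fin n → Bool) → ∃₂ λ x y → x ≢ y × C x ≡ C y
Bool-pigeonhole 2<n C with pigeonhole 2<n (Inverse.from 2↔Bool ∘ C)
... | x , y , x<y , eq = x , y , <⇒≢ x<y , Injection.injective (↔⇒↣ (↔-sym 2↔Bool)) eq

⌊≟ᶠ⌋-true : ∀ {n} {x y : Fin n} → x ≡ y → ⌊ x ≟ᶠ y ⌋ ≡ true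
⌊≟ᶠ⌋-true {x = x} {y} x≡y = trans (isYes≗does (x ≟ᶠ y)) (dec-true (x ≟ᶠ y) x≡y)

⌊≟ᶠ⌋-false : ∀ {n} {x y : Fin n} → x ≢ y → ⌊ x ≟ᶠ y ⌋ ≡ false
⌊≟ᶠ⌋-false {x = x} {y} x≢y = trans (isYes≗does (x ≟ᶠ y)) (dec-false (x ≟ᶠ y) x≢y)

module _ {n : ℕ} (G : Graph n) where

  adjMul : (Fin n → ℚ) → Fin n → ℚ
  adjMul v i = Σℚ n (λ j → adjMatrix G i j * v j)

  closedNbSumℚ : (Fin n → ℚ) → Fin n → ℚ
  closedNbSumℚ v i = Σℚ n (λ j → if inN[] G i j then v j else 0ℚ)

  ClosedSumConstant : (Fin n → ℚ) → ℚ → Set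
  ClosedSumConstant v k = ∀ i → closedNbSumℚ v i ≡ k

  inN[]-sym : ∀ x y → inN[] G x y ≡ inN[] G y x
  inN[]-sym x y = cong₂ _∨_ (≟ᶠ-sym x y) (Graph.sym G x y)
    where
    ≟ᶠ-sym : ∀ x y → ⌊ x ≟ᶠ y ⌋ ≡ ⌊ y ≟ᶠ x ⌋
    ≟ᶠ-sym x y with x ≟ᶠ y
    ... | yes x≡y = sym (⌊≟ᶠ⌋-true (sym x≡y))
    ... | no  x≢y = sym (⌊≟ᶠ⌋-false (x≢y ∘ sym))

  inN[]-refl : ∀ x → T (inN[] G x x)
  inN[]-refl x = Equivalence.from T-∨ (inj₁ (fromWitness {a? = x ≟ᶠ x} refl))

  adj⇒inN[] : ∀ {x y} → adj G x y ≡ true → T (inN[] G x y)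
  adj⇒inN[] xy = Equivalence.from T-∨ (inj₂ (Equivalence.from T-≡ xy))

  closedNb-term-split : ∀ i j x → (if inN[] G i j then x else 0ℚ)
                          ≡ (if ⌊ i ≟ᶠ j ⌋ then x else 0ℚ) + adjMatrix G i j * x
  closedNb-term-split i j x with i ≟ᶠ j
  ... | yes refl rewrite irrefl G i = sym (trans (cong (x +_) (ℚ.*-zeroˡ x)) (ℚ.+-identityʳ x))
  ... | no  _    with adj G i j
  ...   | true  = sym (trans (ℚ.+-identityˡ _) (ℚ.*-identityˡ x))
  ...   | false = sym (trans (ℚ.+-identityˡ _) (ℚ.*-zeroˡ x))

  closedNbSumℚ≡id+adjMul : ∀ v i → closedNbSumℚ v i ≡ v i + adjMul v i
  closedNbSumℚ≡id+adjMul v i = begin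
    closedNbSumℚ v i
      ≡⟨ Σℚ-cong n (λ j → closedNb-term-split i j (v j)) ⟩
    Σℚ n (λ j → self j + adjMatrix G i j * v j)
      ≡⟨ Σℚ-distrib-+ n self _ ⟩
    Σℚ n self + adjMul v i
      ≡⟨ cong (_+ adjMul v i) (Σℚ-single n i self off-diagonal) ⟩
    self i + adjMul v i
      ≡⟨ cong (λ b → (if b then v i else 0ℚ) + adjMul v i) (⌊≟ᶠ⌋-true {x = i} refl) ⟩
    v i + adjMul v i ∎
    where
    self : Fin n → ℚ
    self j = if ⌊ i ≟ᶠ j ⌋ then v j else 0ℚ
    off-diagonal : ∀ j → j ≢ i → self j ≡ 0ℚ
    off-diagonal j j≢i = cong (λ b → if b then v j else 0ℚ) (⌊≟ᶠ⌋-false (j≢i ∘ sym))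

  closedNbSumℚ-linear : ∀ a b f g i →
    closedNbSumℚ (λ j → a * f j + b * g j) i ≡ a * closedNbSumℚ f i + b * closedNbSumℚ g i
  closedNbSumℚ-linear a b f g i =
    trans (Σℚ-cong n (λ j → term (inN[] G i j) (f j) (g j))) (Σℚ-linear n a b _ _)
    where
    term : ∀ β x y → (if β then a * x + b * y else 0ℚ)
                     ≡ a * (if β then x else 0ℚ) + b * (if β then y else 0ℚ)
    term true  x y = refl
    term false x y = sym (trans (cong₂ _+_ (ℚ.*-zeroʳ a) (ℚ.*-zeroʳ b)) (ℚ.+-identityˡ 0ℚ))

  ClosedSumConstant-combination : ∀ {f g a b} → ClosedSumConstant f a → ClosedSumConstant g b →
                                  ClosedSumConstant (λ j → b * f j + (- a) * g j) 0ℚ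
  ClosedSumConstant-combination {f} {g} {a} {b} Nf≡a Ng≡b i = begin
    closedNbSumℚ (λ j → b * f j + (- a) * g j) i
      ≡⟨ closedNbSumℚ-linear b (- a) f g i ⟩
    b * closedNbSumℚ f i + (- a) * closedNbSumℚ g i
      ≡⟨ cong₂ (λ s t → b * s + (- a) * t) (Nf≡a i) (Ng≡b i) ⟩
    b * a + (- a) * b
      ≡⟨ cong₂ _+_ (ℚ.*-comm b a) (sym (ℚ.neg-distribˡ-* a b)) ⟩
    a * b + - (a * b)
      ≡⟨ ℚ.+-inverseʳ (a * b) ⟩
    0ℚ ∎

  ClosedSumConstant-0⇒eigenvector : ∀ {v} → ClosedSumConstant v 0ℚ →
                                    IsEigenvectorFor (adjMatrix G) (- 1ℚ) v
  ClosedSumConstant-0⇒eigenvector {v} Nv≡0 i = begin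
    adjMul v i           ≡⟨ ∙-cancelˡ (v i) _ _ v+Av≡v-v ⟩
    - v i                ≡⟨ -1*x≈-x (v i) ⟨
    - 1ℚ * v i           ∎
    where
    v+Av≡v-v : v i + adjMul v i ≡ v i + - v i
    v+Av≡v-v = begin
      v i + adjMul v i ≡⟨ closedNbSumℚ≡id+adjMul v i ⟨
      closedNbSumℚ v i ≡⟨ Nv≡0 i ⟩
      0ℚ               ≡⟨ ℚ.+-inverseʳ (v i) ⟨
      v i + - v i      ∎

  ClosedSumConstant-fromℕ : ∀ {f k} → (∀ i → closedNbSum G f i ≡ k) →
                            ClosedSumConstant (fromℕ ∘ f) (fromℕ k)
  ClosedSumConstant-fromℕ {f} {k} Nf≡k i = begin
    closedNbSumℚ (fromℕ ∘ f) i ≡⟨ Σℚ-cong n (λ j → if-float fromℕ (inN[] G i j)) ⟨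
    Σℚ n (λ j → fromℕ (if inN[] G i j then f j else 0)) ≡⟨ fromℕ-Σ n _ ⟨
    fromℕ (closedNbSum G f i) ≡⟨ cong fromℕ (Nf≡k i) ⟩
    fromℕ k ∎

  ClosedSumConstant-regular : ∀ {r} → (∀ x → degree G x ≡ r) →
                              ClosedSumConstant (λ _ → 1ℚ) (1ℚ + fromℕ r)
  ClosedSumConstant-regular {r} regular i = begin
    closedNbSumℚ (λ _ → 1ℚ) i ≡⟨ closedNbSumℚ≡id+adjMul (λ _ → 1ℚ) i ⟩
    1ℚ + adjMul (λ _ → 1ℚ) i  ≡⟨ cong (1ℚ +_) (Σℚ-cong n (λ j → ℚ.*-identityʳ (adjMatrix G i j))) ⟩
    1ℚ + Σℚ n (adjMatrix G i) ≡⟨ cong (1ℚ +_) (Σℚ-cong n (λ j → if-float fromℕ (adj G i j))) ⟨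
    1ℚ + Σℚ n (λ j → fromℕ (if adj G i j then 1 else 0)) ≡⟨ cong (1ℚ +_) (fromℕ-Σ n _) ⟨
    1ℚ + fromℕ (degree G i)   ≡⟨ cong (λ d → 1ℚ + fromℕ d) (regular i) ⟩
    1ℚ + fromℕ r              ∎

  ClosedSumConstant-perfectCode : ∀ {C} → PerfectCode G C → ClosedSumConstant (indicator C) 1ℚ
  ClosedSumConstant-perfectCode {C} code i with code i
  ... | c , (c∈C , i∈N[c]) , unique = trans (Σℚ-single n c _ outside-c) at-c
    where
    at-c : (if inN[] G i c then indicator C c else 0ℚ) ≡ 1ℚ
    at-c = cong₂ (λ β γ → if β then (if γ then 1ℚ else 0ℚ) else 0ℚ)
                 (trans (inN[]-sym i c) (Equivalence.to T-≡ i∈N[c]))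
                 (Equivalence.to T-≡ c∈C)
    outside-c : ∀ j → j ≢ c → (if inN[] G i j then indicator C j else 0ℚ) ≡ 0ℚ
    outside-c j j≢c with inN[] G i j in j∈N[i] | C j in j∈C
    ... | false | _     = refl
    ... | true  | false = refl
    ... | true  | true  = ⊥-elim (j≢c (unique j (Equivalence.from T-≡ j∈C)
                             (Equivalence.from T-≡ (trans (inN[]-sym j i) j∈N[i]))))

  perfectCode-everything⇒edgeless : ∀ {C} → PerfectCode G C → (∀ v → T (C v)) →
                                    ∀ x y → adj G x y ≡ false
  perfectCode-everything⇒edgeless {C} code everything x y with adj G x y in xy
  ... | false = refl
  ... | true with code y
  ...   | _ , _ , unique = ⊥-elim (false≢true (begin
    false     ≡⟨ irrefl G x ⟨
    adj G x x ≡⟨ cong (adj G x) x≡y ⟩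
    adj G x y ≡⟨ xy ⟩
    true      ∎))
    where
    x≡y : x ≡ y
    x≡y = trans (unique x (everything x) (adj⇒inN[] xy)) (sym (unique y (everything y) (inN[]-refl y)))
    false≢true : false ≢ true
    false≢true ()

  perfectCode-omits-vertex : ∀ {C v k} → PerfectCode G C → ClosedSumConstant v k →
                             (∀ {x y} → v x ≡ v y → x ≡ y) →
                             ∀ {x y : Fin n} → x ≢ y → ∃ λ z → C z ≡ false
  perfectCode-omits-vertex {C} {v} {k} code Nv≡k v-injective {x} {y} x≢y =
    map₂ (λ z∉C → ¬-not (z∉C ∘ Equivalence.from T-≡)) (¬∀⟶∃¬ n (T ∘ C) (T? ∘ C) not-everything)
    where
    v≡k : (∀ z → T (C z)) → ∀ z → v z ≡ k
    v≡k everything z = begin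
      v z              ≡⟨ ℚ.+-identityʳ (v z) ⟨
      v z + 0ℚ         ≡⟨ cong (v z +_) (Σℚ-zero n no-edge) ⟨
      v z + adjMul v z ≡⟨ closedNbSumℚ≡id+adjMul v z ⟨
      closedNbSumℚ v z ≡⟨ Nv≡k z ⟩
      k                ∎
      where
      no-edge : ∀ j → adjMatrix G z j * v j ≡ 0ℚ
      no-edge j = trans (cong (λ β → (if β then 1ℚ else 0ℚ) * v j)
                              (perfectCode-everything⇒edgeless code everything z j))
                        (ℚ.*-zeroˡ (v j))

    not-everything : ¬ (∀ z → T (C z))
    not-everything everything = x≢y (v-injective (trans (v≡k everything x) (sym (v≡k everything y))))

  multiplicity-−1≥2 : ∀ {C ℓ k ρ} → 2 ℕ.< n → PerfectCode G C →
                      ClosedSumConstant ℓ k → (∀ {x y} → ℓ x ≡ ℓ y → x ≡ y) →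
                      ClosedSumConstant (λ _ → 1ℚ) ρ → MultiplicityAtLeast 2 (adjMatrix G) (- 1ℚ)
  multiplicity-−1≥2 {C} {ℓ} {k} {ρ} 2<n code Nℓ≡k ℓ-injective N𝟙≡ρ
    with Bool-pigeonhole 2<n C
  ... | x , y , x≢y , Cx≡Cy with perfectCode-omits-vertex code Nℓ≡k ℓ-injective x≢y
  ...   | z , Cz≡false = u ∷ w ∷ [] , independent-pair u w wx≡wy ux≢uy wz≢0 , eigen
    where
    χ u w : Fin n → ℚ
    χ = indicator C
    u v = 1ℚ * ℓ v + (- k) * χ v
    w v = ρ * χ v + (- 1ℚ) * 1ℚ

    Nχ≡1 : ClosedSumConstant χ 1ℚ
    Nχ≡1 = ClosedSumConstant-perfectCode code

    eigen : ∀ i → IsEigenvectorFor (adjMatrix G) (- 1ℚ) ((u ∷ w ∷ []) i)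
    eigen zero       = ClosedSumConstant-0⇒eigenvector (ClosedSumConstant-combination Nℓ≡k Nχ≡1)
    eigen (suc zero) = ClosedSumConstant-0⇒eigenvector (ClosedSumConstant-combination Nχ≡1 N𝟙≡ρ)

    χx≡χy : χ x ≡ χ y
    χx≡χy = cong (λ β → if β then 1ℚ else 0ℚ) Cx≡Cy

    wx≡wy : w x ≡ w y
    wx≡wy = cong (λ t → ρ * t + (- 1ℚ) * 1ℚ) χx≡χy

    ux≢uy : u x ≢ u y
    ux≢uy ux≡uy = x≢y (ℓ-injective (begin
      ℓ x      ≡⟨ ℚ.*-identityˡ (ℓ x) ⟨
      1ℚ * ℓ x ≡⟨ ∙-cancelʳ ((- k) * χ y) _ _ (begin
        1ℚ * ℓ x + (- k) * χ y ≡⟨ cong (λ t → 1ℚ * ℓ x + (- k) * t) χx≡χy ⟨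
        u x                    ≡⟨ ux≡uy ⟩
        u y                    ∎) ⟩
      1ℚ * ℓ y ≡⟨ ℚ.*-identityˡ (ℓ y) ⟩
      ℓ y      ∎))

    wz≢0 : w z ≢ 0ℚ
    wz≢0 wz≡0 = ℚ.<⇒≢ (ℚ.negative⁻¹ (- 1ℚ)) (begin
      - 1ℚ                  ≡⟨ ℚ.+-identityˡ (- 1ℚ) ⟨
      0ℚ + (- 1ℚ) * 1ℚ      ≡⟨ cong (_+ (- 1ℚ) * 1ℚ) (ℚ.*-zeroʳ ρ) ⟨
      ρ * 0ℚ + (- 1ℚ) * 1ℚ  ≡⟨ cong (λ β → ρ * (if β then 1ℚ else 0ℚ) + (- 1ℚ) * 1ℚ) Cz≡false ⟨
      w z                   ≡⟨ wz≡0 ⟩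
      0ℚ                    ∎)

mainTheorem5 : (n : ℕ) → 3 ≤ n → (G : Graph n) →
    Regular G → ClosedDistanceMagic G → HasPerfectCode G →
    MultiplicityAtLeast 2 (adjMatrix G) (- 1ℚ)
mainTheorem5 n 2<n G (r , regular) (σ , k , _ , magic) (C , code) =
  multiplicity-−1≥2 G 2<n code (ClosedSumConstant-fromℕ G magic) ℓ-injective
                    (ClosedSumConstant-regular G regular)
  where
  label : Fin n → ℕ
  label v = suc (toℕ (Inverse.to σ v))

  ℓ-injective : ∀ {x y} → fromℕ (label x) ≡ fromℕ (label y) → x ≡ y
  ℓ-injective = Injection.injective (↔⇒↣ σ) ∘ toℕ-injective ∘ ℕ.suc-injective ∘ fromℕ-injective
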